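{- Let $\xi$ be a type variable valuation such that $\xi(A)$ is approximation expansion closed for every type variable $A$, and let $v$ be a size variable valuation. Then for every strictly positive type $\tau$, the set $[\![\tau]\!]_{\xi,v}$ is approximation expansion closed.
   Context: Terms and reduction. $\mathbb{T}^\infty$ is the set of finite and infinite terms (modulo $\alpha$-conversion) generated by $t ::= x \mid c \mid \lambda x.t \mid t\,t \mid \mathrm{case}(t;\{c_k\vec{x}_k \Rightarrow t_k \mid k=1,\dots,n\})$. $\to_{\beta\iota}$ is the closure under term contexts of $(\lambda x.t)t' \to t[t'/x]$ and $\mathrm{case}(c_k\vec u;\{c_l\vec x_l\Rightarrow t_l\}) \to t_k[\vec u/\vec x_k]$; $\to^*$ its reflexive–transitive closure. $\to^\infty$ is the largest relation such that $t\to^\infty t'$ implies one of: $t'$ a variable or constructor with $t\to^*t'$; $t'=\lambda x.r'$, $t\to^*\lambda x.r$, $r\to^\infty r'$; $t'=r_1'r_2'$, $t\to^*r_1r_2$, $r_i\to^\infty r_i'$; $t'=\mathrm{case}(r';\{c_k\vec x_k\Rightarrow r_k'\})$, $t\to^*\mathrm{case}(r;\{c_k\vec x_k\Rightarrow r_k\})$, $r\to^\infty r'$, $r_k\to^\infty r_k'$. Approximation. $\bot=(\lambda x.xx)(\lambda x.xx)$. $\succ$ is the largest relation such that $t\succ t'$ implies: $t'=\bot$; or $t=t'$ a variable or constructor; or $t=\lambda x.p$, $t'=\lambda x.p'$, $p\succ p'$; or $t=p_1p_2$, $t'=p_1'p_2'$, $p_i\succ p_i'$; or $t=\mathrm{case}(p;\{c_k\vec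 x\Rightarrow p_k\})$, $t'=\mathrm{case}(p';\{c_k\vec x\Rightarrow p_k'\})$, $p\succ p'$, $p_k\succ p_k'$. A set $X\subseteq\mathbb{T}^\infty$ is approximation expansion closed if $t'\in X$ and $t\succ t'$ imply $t\in X$. Types. Size expressions $s::=\infty\mid0\mid i\mid s+1\mid\min(s,s)\mid\max(s,s)$. Types $\tau::=A\mid d^s(\vec\tau)\mid\tau_1\to\tau_2\mid\forall i.\tau$. Closed = no type variables. Strictly positive: closed, a type variable, $\tau_1\to\tau_2$ with $\tau_1$ closed and $\tau_2$ s.p., $\forall i.\tau'$ with $\tau'$ s.p., or $d^\infty(\vec\alpha)$ with all $\alpha_k$ s.p. Each $d$ has a definition $d(B_1..B_n)=\mathrm{CoInd}(A)\{c_k:\sigma_k^1,\dots,\sigma_k^{n_k}\mid k=1..m\}$ or with $\mathrm{Ind}$ (recursive type variable $A$, parameters $B_j$, $m>0$, argument types strictly positive with type variables among $A,\vec B$ and no free size variables, each constructor in one definition, definitions well-founded ordered with those occurring in argument types of $d$ below $d$). Semantics. $\infty$ also denotes an ordinal larger than $|\mathcal{P}(\mathbb{T}^\infty)|$, $\Omega$ the ordinals $\le\infty$. Size valuations $v$ map size variables to $\Omega$, extended by $v(\infty)=\infty$, $v(0)=0$, $v(s+1)=\min(v(s)+1,\infty)$, and $\min,\max$ pointwise. Type variable valuations $\xi$ map type variables to subsets of $\mathbb{T}^\infty$. $\Phi_{d,\xi,v}(X)=\{c_kt^1\cdots t^{n_k}: t^l\in[\![\sigma_k^l]\!]_{\xi[X/A],v}\}$;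 coinductive $d$: $[\![d]\!]^0_{\xi,v}=\mathbb{T}^\infty$, $[\![d]\!]^{\varkappa+1}_{\xi,v}=\Phi_{d,\xi,v}([\![d]\!]^\varkappa_{\xi,v})$, intersection at limits; inductive: $\emptyset$, $\Phi$, union at limits. $[\![d(\vec\alpha)]\!]^\varkappa_{\xi,v}=[\![d]\!]^\varkappa_{\xi[\vec Y/\vec B],v}$, $Y_j=[\![\alpha_j]\!]_{\xi,v}$; $[\![d^s(\vec\alpha)]\!]_{\xi,v}=[\![d(\vec\alpha)]\!]^{v(s)}_{\xi,v}$; $[\![A]\!]_{\xi,v}=\xi(A)$; $t\in[\![\forall i.\tau]\!]_{\xi,v}$ iff for all $\varkappa\in\Omega$ some $t'$ has $t\to^\infty t'\in[\![\tau]\!]_{\xi,v[\varkappa/i]}$; $t\in[\![\alpha\to\beta]\!]_{\xi,v}$ iff for all $r\in[\![\alpha]\!]_{\xi,v}$ some $t'$ has $tr\to^\infty t'\in[\![\beta]\!]_{\xi,v}$. -}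

module Defs where

open import Level using (Lift)
open import Data.Nat using (ℕ; zero; suc; _<_; _⊔_; _≟_; _<?_; _+_; _∸_)
open import Data.Fin using (Fin)
import Data.Fin as Fin
open import Data.Vec using (Vec; lookup)
open import Data.Maybe using (Maybe; just; nothing)
open import Data.Sum using (_⊎_; inj₁; inj₂)
open import Data.List using (List; []; _∷_; _++_; length; [_])
open import Data.List.Relation.Unary.All using (All)
open import Data.List.Relation.Binary.Pointwise using (Pointwise)
open import Data.List.Relation.Unary.Unique.Propositional using (Unique)
open import Data.List.Membership.Propositional using (_∈_)
open import Data.Product using (Σ; _×_; _,_)
open import Data.Empty using (⊥)
open import Data.Unit using (⊤; tt)
open import Data.Bool using (Bool; true; false)
open import Relation.Binary.PropositionalEquality using (_≡_; _≢_)
open import Relation.Nullary using (yes; no)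
open import Relation.Binary.Construct.Closure.ReflexiveTransitive using (Star)

-- De Bruijn indices (so α-conversion is built in); constructor names are ℕ.
-- case(t; {c_k x⃗_k ⇒ t_k | k = 1..n}) is  case t n cs ar bs  where
-- lookup cs k = c_k, lookup ar k = |x⃗_k|, and bs k = t_k lives under
-- lookup ar k binders (de Bruijn index 0 is the last variable of x⃗_k).

data NodeF (X : Set₁) : Set₁ where
  var  : ℕ → NodeF X
  con  : ℕ → NodeF X
  lam  : X → NodeF X
  app  : X → X → NodeF X
  case : X → (n : ℕ) → Vec ℕ n → Vec ℕ n → (Fin n → X) → NodeF X

data NodeS (X : Set) : Set where
  var  : ℕ → NodeS X
  con  : ℕ → NodeS X
  lam  : X → NodeS X
  app  : X → X → NodeS X
  case : X → (n : ℕ) → Vec ℕ n → Vec ℕ n → (Fin n → X) → NodeS X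

-- An (in general infinite) term is presented as a state of a coalgebra
-- (the guardedness option needed for coinductive records is not
-- available); two presentations denote the same term iff bisimilar.
record Term : Set₁ where
  field
    St   : Set
    root : St
    out  : St → NodeS St

open Term public

mapS : {X : Set} {Y : Set₁} → (X → Y) → NodeS X → NodeF Y
mapS f (var x)             = var x
mapS f (con c)             = con c
mapS f (lam b)             = lam (f b)
mapS f (app a b)           = app (f a) (f b)
mapS f (case s n cs ar bs) = case (f s) n cs ar (λ k → f (bs k))

mapSS : {X Y : Set} → (X → Y) → NodeS X → NodeS Y
mapSS f (var x)             = var x
mapSS f (con c)             = con c
mapSS f (lam b)             = lam (f b)
mapSS f (app a b)           = app (f a) (f b)
mapSS f (case s n cs ar bs) = case (f s) n cs ar (λ k → f (bs k))

at : (t : Term) → St t → Term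
at t s = record { St = St t ; root = s ; out = out t }

node : Term → NodeF Term
node t = mapS (at t) (out t (root t))

Pos : {X : Set₁} → NodeF X → Set
Pos (var _)            = ⊥
Pos (con _)            = ⊥
Pos (lam _)            = ⊤
Pos (app _ _)          = Bool
Pos (case _ n _ _ _)   = Maybe (Fin n)

child : {X : Set₁} (nd : NodeF X) → Pos nd → X
child (lam b)             _          = b
child (app f a)           true       = f
child (app f a)           false      = a
child (case s n cs ar bs) nothing    = s
child (case s n cs ar bs) (just k)   = bs k

PosS : {X : Set} → NodeS X → Set
PosS (var _)            = ⊥
PosS (con _)            = ⊥
PosS (lam _)            = ⊤
PosS (app _ _)          = Bool
PosS (case _ n _ _ _)   = Maybe (Fin n)

childS : {X : Set} (nd : NodeS X) → PosS nd → X
childS (lam b)             _          = b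
childS (app f a)           true       = f
childS (app f a)           false      = a
childS (case s n cs ar bs) nothing    = s
childS (case s n cs ar bs) (just k)   = bs k

bindersS : {X : Set} (nd : NodeS X) → PosS nd → ℕ
bindersS (lam b)             _          = 1
bindersS (app f a)           _          = 0
bindersS (case s n cs ar bs) nothing    = 0
bindersS (case s n cs ar bs) (just k)   = lookup ar k

rebuild : {X Y : Set} → (ℕ → NodeS Y) → (nd : NodeS X) → ((p : PosS nd) → Y) → NodeS Y
rebuild vf (var x)             g = vf x
rebuild vf (con c)             g = con c
rebuild vf (lam b)             g = lam (g tt)
rebuild vf (app f a)           g = app (g true) (g false)
rebuild vf (case s n cs ar bs) g = case (g nothing) n cs ar (λ k → g (just k))

rebuildF : {X : Set₁} {Y : Set} → (nd : NodeF X) → ((p : Pos nd) → Y) → NodeS Y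
rebuildF (var x)             g = var x
rebuildF (con c)             g = con c
rebuildF (lam b)             g = lam (g tt)
rebuildF (app f a)           g = app (g true) (g false)
rebuildF (case s n cs ar bs) g = case (g nothing) n cs ar (λ k → g (just k))

mk : NodeF Term → Term
mk nd = record { St = StM ; root = inj₁ tt ; out = outM }
  where
    StM : Set
    StM = ⊤ ⊎ Σ (Pos nd) (λ p → St (child nd p))
    outM : StM → NodeS StM
    outM (inj₁ _)       = rebuildF nd (λ p → inj₂ (p , root (child nd p)))
    outM (inj₂ (p , s)) = mapSS (λ s' → inj₂ (p , s')) (out (child nd p) s)

var' : ℕ → Term
var' x = mk (var x)

app' : Term → Term → Term
app' f a = mk (app f a)

subst : (ℕ → Term) → Term → Term
subst σ t = record { St = SSt ; root = inj₁ (root t , 0) ; out = outS }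
  where
    SSt : Set
    SSt = (St t × ℕ) ⊎ Σ ℕ (λ y → St (σ y) × ℕ × ℕ)
    -- inj₁ (s , k)       : state s of t, below k binders of t
    -- inj₂ (y , s , k , j) : state s of σ y, shifted by k, below j binders of σ y
    outσ : (y : ℕ) → St (σ y) → ℕ → ℕ → NodeS SSt
    outσ y s k j = rebuild vf (out (σ y) s) (λ p → inj₂ (y , childS (out (σ y) s) p , k , j + bindersS (out (σ y) s) p))
      where
        vf : ℕ → NodeS SSt
        vf z with z <? j
        ... | yes _ = var z
        ... | no  _ = var (z + k)
    outS : SSt → NodeS SSt
    outS (inj₁ (s , k)) = rebuild vf (out t s) (λ p → inj₁ (childS (out t s) p , k + bindersS (out t s) p))
      where
        vf : ℕ → NodeS SSt
        vf x with x <? k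
        ... | yes _ = var x
        ... | no  _ = outσ (x ∸ k) (root (σ (x ∸ k))) k 0
    outS (inj₂ (y , s , k , j)) = outσ y s k j

consσ : Term → (ℕ → Term) → ℕ → Term
consσ a σ zero    = a
consσ a σ (suc x) = σ x

_[_≔0] : Term → Term → Term
b [ a ≔0] = subst (consσ a var') b

-- b [ u1 … un ]* for a body under n binders x1 … xn (xn has index 0)
substListσ : (ℕ → Term) → List Term → ℕ → Term
substListσ σ []       = σ
substListσ σ (u ∷ us) = substListσ (consσ u σ) us

_[_]* : Term → List Term → Term
b [ us ]* = subst (substListσ var' us) b

data Spine : Term → ℕ → List Term → Set₁ where
  sp-con : ∀ {t c} → node t ≡ con c → Spine t c []
  sp-app : ∀ {t f a c us} → node t ≡ app f a → Spine f c us → Spine t c (us ++ [ a ])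

updF : ∀ {n} → (Fin n → Term) → Fin n → Term → Fin n → Term
updF bs k b j with j Fin.≟ k
... | yes _ = b
... | no  _ = bs j

data _⟶_ : Term → Term → Set₁ where
  β      : ∀ {t f a b} → node t ≡ app f a → node f ≡ lam b → t ⟶ (b [ a ≔0])
  ι      : ∀ {t s n cs ar bs us} → node t ≡ case s n cs ar bs → (k : Fin n) →
           Spine s (lookup cs k) us → length us ≡ lookup ar k → t ⟶ (bs k [ us ]*)
  ξ-lam  : ∀ {t b b'} → node t ≡ lam b → b ⟶ b' → t ⟶ mk (lam b')
  ξ-appˡ : ∀ {t f f' a} → node t ≡ app f a → f ⟶ f' → t ⟶ mk (app f' a)
  ξ-appʳ : ∀ {t f a a'} → node t ≡ app f a → a ⟶ a' → t ⟶ mk (app f a')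
  ξ-caseˢ : ∀ {t s s' n cs ar bs} → node t ≡ case s n cs ar bs → s ⟶ s' →
            t ⟶ mk (case s' n cs ar bs)
  ξ-caseᵇ : ∀ {t s n cs ar bs b'} → node t ≡ case s n cs ar bs → (k : Fin n) → bs k ⟶ b' →
            t ⟶ mk (case s n cs ar (updF bs k b'))

_⟶*_ : Term → Term → Set₁
_⟶*_ = Star _⟶_

-- greatest fixed points of monotone operators on relations:
-- the union of all post-fixed relations
Rel₁ : Set₂
Rel₁ = Term → Term → Set₁

record Greatest (F : Rel₁ → Rel₁) (t t' : Term) : Set₂ where
  field
    R     : Rel₁
    post  : ∀ a b → R a b → F R a b
    holds : R t t'

data InfStep (R : Rel₁) (t t' : Term) : Set₁ where
  i-var  : ∀ {r x} → t ⟶* r → node r ≡ var x → node t' ≡ var x → InfStep R t t'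
  i-con  : ∀ {r c} → t ⟶* r → node r ≡ con c → node t' ≡ con c → InfStep R t t'
  i-lam  : ∀ {r b b'} → t ⟶* r → node r ≡ lam b → node t' ≡ lam b' → R b b' → InfStep R t t'
  i-app  : ∀ {r r₁ r₂ r₁' r₂'} → t ⟶* r → node r ≡ app r₁ r₂ → node t' ≡ app r₁' r₂' →
           R r₁ r₁' → R r₂ r₂' → InfStep R t t'
  i-case : ∀ {r s s' n cs ar bs bs'} → t ⟶* r → node r ≡ case s n cs ar bs →
           node t' ≡ case s' n cs ar bs' → R s s' → (∀ k → R (bs k) (bs' k)) → InfStep R t t'

_⟶∞_ : Term → Term → Set₂
_⟶∞_ = Greatest InfStep

data IsSelfApp (p : Term) : Set₁ where
  selfapp : ∀ {b x y} → node p ≡ lam b → node b ≡ app x y → node x ≡ var 0 → node y ≡ var 0 →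
            IsSelfApp p

data IsBot (t : Term) : Set₁ where
  isbot : ∀ {p q} → node t ≡ app p q → IsSelfApp p → IsSelfApp q → IsBot t

data ApproxStep (R : Rel₁) (t t' : Term) : Set₁ where
  a-bot  : IsBot t' → ApproxStep R t t'
  a-var  : ∀ {x} → node t ≡ var x → node t' ≡ var x → ApproxStep R t t'
  a-con  : ∀ {c} → node t ≡ con c → node t' ≡ con c → ApproxStep R t t'
  a-lam  : ∀ {p p'} → node t ≡ lam p → node t' ≡ lam p' → R p p' → ApproxStep R t t'
  a-app  : ∀ {p₁ p₂ p₁' p₂'} → node t ≡ app p₁ p₂ → node t' ≡ app p₁' p₂' →
           R p₁ p₁' → R p₂ p₂' → ApproxStep R t t'
  a-case : ∀ {p p' n cs ar ps ps'} → node t ≡ case p n cs ar ps →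
           node t' ≡ case p' n cs ar ps' → R p p' → (∀ k → R (ps k) (ps' k)) → ApproxStep R t t'

_≻_ : Term → Term → Set₂
_≻_ = Greatest ApproxStep

Pred : Set₃
Pred = Term → Set₂

ApproxExpansionClosed : Pred → Set₂
ApproxExpansionClosed X = ∀ t t' → X t' → t ≻ t' → X t

-- Ordinals (Brouwer trees; a tree denotes the ordinal obtained by
-- interpreting olim as supremum)

data Ord : Set₁ where
  oz   : Ord
  os   : Ord → Ord
  olim : (I : Set) → (I → Ord) → Ord

data _≤ₒ_ : Ord → Ord → Set₁ where
  z≤   : ∀ {b} → oz ≤ₒ b
  s≤s  : ∀ {a b} → a ≤ₒ b → os a ≤ₒ os b
  lim≤ : ∀ {I f b} → (∀ i → f i ≤ₒ b) → olim I f ≤ₒ b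
  ≤lim : ∀ {I f a} → (i : I) → a ≤ₒ f i → a ≤ₒ olim I f

omin : Ord → Ord → Ord
omin oz          b          = oz
omin (os a)      oz         = oz
omin (os a)      (os b)     = os (omin a b)
omin (os a)      (olim I g) = olim I (λ j → omin (os a) (g j))
omin (olim I f)  b          = olim I (λ i → omin (f i) b)

omax : Ord → Ord → Ord
omax a b = olim Bool (λ { true → a ; false → b })

data Size : Set where
  s∞   : Size
  s0   : Size
  svar : ℕ → Size
  s+1  : Size → Size
  smin : Size → Size → Size
  smax : Size → Size → Size

data Ty : Set where
  tvar : ℕ → Ty
  dat  : ℕ → Size → List Ty → Ty
  _⇒_  : Ty → Ty → Ty
  ∀ₛ   : ℕ → Ty → Ty

infixr 5 _⇒_

data Closed : Ty → Set where
  c-dat : ∀ {d s αs} → All Closed αs → Closed (dat d s αs)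
  c-arr : ∀ {a b} → Closed a → Closed b → Closed (a ⇒ b)
  c-all : ∀ {i τ} → Closed τ → Closed (∀ₛ i τ)

data StrictlyPositive : Ty → Set where
  sp-closed : ∀ {τ} → Closed τ → StrictlyPositive τ
  sp-var    : ∀ {A} → StrictlyPositive (tvar A)
  sp-arr    : ∀ {a b} → Closed a → StrictlyPositive b → StrictlyPositive (a ⇒ b)
  sp-all    : ∀ {i τ} → StrictlyPositive τ → StrictlyPositive (∀ₛ i τ)
  sp-dat    : ∀ {d αs} → All StrictlyPositive αs → StrictlyPositive (dat d s∞ αs)

data TyVarsIn (Vs : List ℕ) : Ty → Set where
  tv-var : ∀ {A} → A ∈ Vs → TyVarsIn Vs (tvar A)
  tv-dat : ∀ {d s αs} → All (TyVarsIn Vs) αs → TyVarsIn Vs (dat d s αs)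
  tv-arr : ∀ {a b} → TyVarsIn Vs a → TyVarsIn Vs b → TyVarsIn Vs (a ⇒ b)
  tv-all : ∀ {i τ} → TyVarsIn Vs τ → TyVarsIn Vs (∀ₛ i τ)

data SizeVarsIn (Is : List ℕ) : Size → Set where
  sv-∞   : SizeVarsIn Is s∞
  sv-0   : SizeVarsIn Is s0
  sv-var : ∀ {i} → i ∈ Is → SizeVarsIn Is (svar i)
  sv-+1  : ∀ {s} → SizeVarsIn Is s → SizeVarsIn Is (s+1 s)
  sv-min : ∀ {s s'} → SizeVarsIn Is s → SizeVarsIn Is s' → SizeVarsIn Is (smin s s')
  sv-max : ∀ {s s'} → SizeVarsIn Is s → SizeVarsIn Is s' → SizeVarsIn Is (smax s s')

data FreeSizeVarsIn : List ℕ → Ty → Set where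
  fs-var : ∀ {Is A} → FreeSizeVarsIn Is (tvar A)
  fs-dat : ∀ {Is d s αs} → SizeVarsIn Is s → All (FreeSizeVarsIn Is) αs →
           FreeSizeVarsIn Is (dat d s αs)
  fs-arr : ∀ {Is a b} → FreeSizeVarsIn Is a → FreeSizeVarsIn Is b → FreeSizeVarsIn Is (a ⇒ b)
  fs-all : ∀ {Is i τ} → FreeSizeVarsIn (i ∷ Is) τ → FreeSizeVarsIn Is (∀ₛ i τ)

data DataBelow (d : ℕ) : Ty → Set where
  db-var : ∀ {A} → DataBelow d (tvar A)
  db-dat : ∀ {d' s αs} → d' < d → All (DataBelow d) αs → DataBelow d (dat d' s αs)
  db-arr : ∀ {a b} → DataBelow d a → DataBelow d b → DataBelow d (a ⇒ b)
  db-all : ∀ {i τ} → DataBelow d τ → DataBelow d (∀ₛ i τ)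

-- Datatype definitions
-- d(B₁ … Bₙ) = Ind/CoInd(A){ c_k : σ_k^1, …, σ_k^{n_k} | k = 1..m }

data Kind : Set where
  Ind CoInd : Kind

record DataDef : Set where
  field
    kind    : Kind
    recVar  : ℕ
    params  : List ℕ
    ncons   : ℕ
    conName : Fin ncons → ℕ
    conArgs : Fin ncons → List Ty

open DataDef public

-- a signature assigns a definition to every datatype name d : ℕ;
-- the well-founded order on definitions is the order of ℕ
record WellFormedSig (Sig : ℕ → DataDef) : Set where
  field
    cons-nonempty : ∀ d → 0 < ncons (Sig d)
    vars-distinct : ∀ d → Unique (recVar (Sig d) ∷ params (Sig d))
    args-sp       : ∀ d k σ → σ ∈ conArgs (Sig d) k → StrictlyPositive σ
    args-tyvars   : ∀ d k σ → σ ∈ conArgs (Sig d) k → TyVarsIn (recVar (Sig d) ∷ params (Sig d)) σ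
    args-sizes    : ∀ d k σ → σ ∈ conArgs (Sig d) k → FreeSizeVarsIn [] σ
    args-below    : ∀ d k σ → σ ∈ conArgs (Sig d) k → DataBelow d σ
    con-one-def   : ∀ d d' k k' → conName (Sig d) k ≡ conName (Sig d') k' → d ≡ d'
    con-distinct  : ∀ d k k' → conName (Sig d) k ≡ conName (Sig d) k' → k ≡ k'

updT : (ℕ → Pred) → ℕ → Pred → (ℕ → Pred)
updT ξ A X B with B ≟ A
... | yes _ = X
... | no  _ = ξ B

updO : (ℕ → Ord) → ℕ → Ord → (ℕ → Ord)
updO v i κ j with j ≟ i
... | yes _ = κ
... | no  _ = v j

-- ∞ is a parameter (the paper's fixed ordinal ∞)
evalS : Ord → (ℕ → Ord) → Size → Ord
evalS ∞ v s∞         = ∞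
evalS ∞ v s0         = oz
evalS ∞ v (svar i)   = v i
evalS ∞ v (s+1 s)    = omin (os (evalS ∞ v s)) ∞
evalS ∞ v (smin s s') = omin (evalS ∞ v s) (evalS ∞ v s')
evalS ∞ v (smax s s') = omax (evalS ∞ v s) (evalS ∞ v s')

iterK : Kind → (Pred → Pred) → Ord → Pred
iterK CoInd Φ oz t         = Lift _ ⊤
iterK CoInd Φ (os κ)       = Φ (iterK CoInd Φ κ)
iterK CoInd Φ (olim I f) t = ∀ i → iterK CoInd Φ (f i) t
iterK Ind   Φ oz t         = Lift _ ⊥
iterK Ind   Φ (os κ)       = Φ (iterK Ind Φ κ)
iterK Ind   Φ (olim I f) t = Σ I λ i → iterK Ind Φ (f i) t

module Semantics (Sig : ℕ → DataDef) (∞ : Ord) where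

  -- sem n ξ v τ : the interpretation, where n bounds the datatype
  -- definitions that may be unfolded (fuel; see ⟦_⟧ below)
  mutual
    sem : ℕ → (ℕ → Pred) → (ℕ → Ord) → Ty → Pred
    sem n ξ v (tvar A) = ξ A
    sem n ξ v (α ⇒ ρ) t =
      ∀ r → sem n ξ v α r → Σ Term λ t' → (app' t r ⟶∞ t') × sem n ξ v ρ t'
    sem n ξ v (∀ₛ i τ) t =
      ∀ κ → κ ≤ₒ ∞ → Σ Term λ t' → (t ⟶∞ t') × sem n ξ (updO v i κ) τ t'
    sem zero    ξ v (dat d s αs) t = Lift _ ⊥
    sem (suc n) ξ v (dat d s αs) =
      iterK (kind (Sig d))
            (Φ n d (bindParams (suc n) ξ v ξ (params (Sig d)) αs) v)
            (evalS ∞ v s)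

    Φ : ℕ → (d : ℕ) → (ℕ → Pred) → (ℕ → Ord) → Pred → Pred
    Φ n d ξ v X t =
      Σ (Fin (ncons (Sig d))) λ k → Σ (List Term) λ us →
        Spine t (conName (Sig d) k) us ×
        Pointwise (λ u σ → sem n (updT ξ (recVar (Sig d)) X) v σ u) us (conArgs (Sig d) k)

    bindParams : ℕ → (ℕ → Pred) → (ℕ → Ord) → (ℕ → Pred) → List ℕ → List Ty → (ℕ → Pred)
    bindParams m ξ v acc (B ∷ Bs) (α ∷ αs) = bindParams m ξ v (updT acc B (sem m ξ v α)) Bs αs
    bindParams m ξ v acc _        _        = acc

  mutual
    maxData : Ty → ℕ
    maxData (tvar A)     = 0
    maxData (dat d s αs) = d ⊔ maxDataL αs
    maxData (a ⇒ b)      = maxData a ⊔ maxData b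
    maxData (∀ₛ i τ)     = maxData τ

    maxDataL : List Ty → ℕ
    maxDataL []       = 0
    maxDataL (α ∷ αs) = maxData α ⊔ maxDataL αs

  -- ⟦ τ ⟧ ξ v  (enough fuel to unfold every definition reachable from τ,
  -- given that argument types only mention smaller datatypes)
  ⟦_⟧ : Ty → (ℕ → Pred) → (ℕ → Ord) → Pred
  ⟦ τ ⟧ ξ v = sem (suc (maxData τ)) ξ v τ

-- Type variables are closed by assumption; for a datatype, Φ
-- preserves closed sets (a term approximating a constructor spine is a spine
-- with the same constructor), hence so does every stage of the transfinite
-- iteration.  For → and ∀, membership is witnessed by a reduct t' →∞ s', and
-- the heart of the proof is that approximation commutes with infinitary
-- reduction: t ≻ t' →∞ s' gives t →∞ s ≻ s'.  Finitarily, every step of t' is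
-- matched by a step of t, except a step inside a ⊥ that t' has in place of a
-- subterm of t, which needs none because ⊥ only reduces to ⊥; the term s is
-- then built corecursively, one layer at a time.

module Submission where

open import Defs
open import Level using (Level; Lift; lift; 0ℓ; _⊔_)
import Level
open import Data.Nat using (ℕ; zero; suc; _+_; _∸_; _<_; _<?_; _≟_; z<s)
open import Data.Fin using (Fin; toℕ; fromℕ<)
import Data.Fin as Fin
open import Data.Fin.Properties using (toℕ<n; fromℕ<-toℕ)
open import Data.Vec using (Vec; lookup)
open import Data.Maybe using (Maybe; just; nothing; maybe′; is-just; _>>=_)
open import Data.List using (List; []; _∷_; _++_; [_]; length)
open import Data.List.Relation.Binary.Pointwise using (Pointwise; []; _∷_; ++⁺; Pointwise-length)
open import Data.Sum using (_⊎_; inj₁; inj₂; map₂)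
open import Data.Product using (Σ; _×_; _,_; proj₂)
open import Data.Empty using (⊥; ⊥-elim)
open import Data.Unit using (⊤; tt)
open import Data.Bool using (Bool; true; false; if_then_else_; T)
open import Relation.Nullary using (¬_; yes; no)
open import Relation.Binary.PropositionalEquality using (_≡_; refl; sym; trans; cong; subst₂)
import Relation.Binary.PropositionalEquality as ≡
open import Relation.Binary.Construct.Closure.ReflexiveTransitive using (ε; _◅_)

data LayerRel {ℓ : Level} (R : Term → Term → Set ℓ) :
              NodeF Term → NodeF Term → Set (Level.suc 0ℓ ⊔ ℓ) where
  var  : ∀ {x} → LayerRel R (var x) (var x)
  con  : ∀ {c} → LayerRel R (con c) (con c)
  lam  : ∀ {p p'} → R p p' → LayerRel R (lam p) (lam p')
  app  : ∀ {p₁ p₂ p₁' p₂'} → R p₁ p₁' → R p₂ p₂' → LayerRel R (app p₁ p₂) (app p₁' p₂')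
  case : ∀ {p p' n cs ar ps ps'} → R p p' → (∀ k → R (ps k) (ps' k)) →
         LayerRel R (case p n cs ar ps) (case p' n cs ar ps')

module _ {ℓ : Level} {R : Term → Term → Set ℓ} where

  LayerRel-atNodes : ∀ {t t' nd nd'} → node t ≡ nd → node t' ≡ nd' →
                     LayerRel R nd nd' → LayerRel R (node t) (node t')
  LayerRel-atNodes e e' = subst₂ (LayerRel R) (sym e) (sym e')

  LayerRel-varˡ⁻ : ∀ {x nd} → LayerRel R (var x) nd → nd ≡ var x
  LayerRel-varˡ⁻ var = refl

  LayerRel-lamˡ⁻ : ∀ {p nd} → LayerRel R (lam p) nd → Σ Term λ p' → nd ≡ lam p' × R p p'
  LayerRel-lamˡ⁻ (lam r) = _ , refl , r

  LayerRel-appˡ⁻ : ∀ {p₁ p₂ nd} → LayerRel R (app p₁ p₂) nd →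
                   Σ Term λ p₁' → Σ Term λ p₂' → nd ≡ app p₁' p₂' × R p₁ p₁' × R p₂ p₂'
  LayerRel-appˡ⁻ (app r₁ r₂) = _ , _ , refl , r₁ , r₂

  LayerRel-conʳ⁻ : ∀ {c nd} → LayerRel R nd (con c) → nd ≡ con c
  LayerRel-conʳ⁻ con = refl

  LayerRel-lamʳ⁻ : ∀ {p' nd} → LayerRel R nd (lam p') → Σ Term λ p → nd ≡ lam p × R p p'
  LayerRel-lamʳ⁻ (lam r) = _ , refl , r

  LayerRel-appʳ⁻ : ∀ {p₁' p₂' nd} → LayerRel R nd (app p₁' p₂') →
                   Σ Term λ p₁ → Σ Term λ p₂ → nd ≡ app p₁ p₂ × R p₁ p₁' × R p₂ p₂'
  LayerRel-appʳ⁻ (app r₁ r₂) = _ , _ , refl , r₁ , r₂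

  LayerRel-caseʳ⁻ : ∀ {p' n cs ar ps' nd} → LayerRel R nd (case p' n cs ar ps') →
                    Σ Term λ p → Σ (Fin n → Term) λ ps →
                      nd ≡ case p n cs ar ps × R p p' × (∀ k → R (ps k) (ps' k))
  LayerRel-caseʳ⁻ (case r rs) = _ , _ , refl , r , rs

LayerRel-map : ∀ {ℓ ℓ'} {R : Term → Term → Set ℓ} {S : Term → Term → Set ℓ'} →
               (∀ {a b} → R a b → S a b) →
               ∀ {nd nd'} → LayerRel R nd nd' → LayerRel S nd nd'
LayerRel-map f var         = var
LayerRel-map f con         = con
LayerRel-map f (lam r)     = lam (f r)
LayerRel-map f (app r₁ r₂) = app (f r₁) (f r₂)
LayerRel-map f (case r rs) = case (f r) (λ k → f (rs k))

LayerRel-trans : ∀ {ℓ} {R S U : Term → Term → Set ℓ} → (∀ {a b c} → R a b → S b c → U a c) →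
                 ∀ {nd₁ nd₂ nd₃} → LayerRel R nd₁ nd₂ → LayerRel S nd₂ nd₃ →
                 LayerRel U nd₁ nd₃
LayerRel-trans _∘_ var          var          = var
LayerRel-trans _∘_ con          con          = con
LayerRel-trans _∘_ (lam r)      (lam s)      = lam (r ∘ s)
LayerRel-trans _∘_ (app r₁ r₂)  (app s₁ s₂)  = app (r₁ ∘ s₁) (r₂ ∘ s₂)
LayerRel-trans _∘_ (case r rs)  (case s ss)  = case (r ∘ s) (λ k → rs k ∘ ss k)

module _ {X : Set} (f : X → Term) where

  mapS-var⁻ : ∀ (o : NodeS X) {x} → mapS f o ≡ var x → o ≡ var x
  mapS-var⁻ (var _) refl = refl

  mapS-lam⁻ : ∀ (o : NodeS X) {p} → mapS f o ≡ lam p → Σ X λ s → o ≡ lam s × f s ≡ p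
  mapS-lam⁻ (lam s) refl = s , refl , refl

  mapS-app⁻ : ∀ (o : NodeS X) {p q} → mapS f o ≡ app p q →
              Σ X λ s₁ → Σ X λ s₂ → o ≡ app s₁ s₂ × f s₁ ≡ p × f s₂ ≡ q
  mapS-app⁻ (app s₁ s₂) refl = s₁ , s₂ , refl , refl , refl

SelfAppAt : (u : Term) → St u → Set
SelfAppAt u s = Σ (St u) λ b → Σ (St u) λ x → Σ (St u) λ y →
  out u s ≡ lam b × out u b ≡ app x y × out u x ≡ var 0 × out u y ≡ var 0

BotAt : (u : Term) → St u → Set
BotAt u s = Σ (St u) λ s₁ → Σ (St u) λ s₂ →
  out u s ≡ app s₁ s₂ × SelfAppAt u s₁ × SelfAppAt u s₂

IsSelfApp⇒SelfAppAt : ∀ u s → IsSelfApp (at u s) → SelfAppAt u s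
IsSelfApp⇒SelfAppAt u s (selfapp e₁ e₂ e₃ e₄) with mapS-lam⁻ (at u) (out u s) e₁
... | b , eb , refl with mapS-app⁻ (at u) (out u b) e₂
... | x , y , exy , refl , refl =
  b , x , y , eb , exy , mapS-var⁻ (at u) (out u x) e₃ , mapS-var⁻ (at u) (out u y) e₄

SelfAppAt⇒IsSelfApp : ∀ u s → SelfAppAt u s → IsSelfApp (at u s)
SelfAppAt⇒IsSelfApp u s (_ , _ , _ , e₁ , e₂ , e₃ , e₄) =
  selfapp (cong (mapS (at u)) e₁) (cong (mapS (at u)) e₂) (cong (mapS (at u)) e₃) (cong (mapS (at u)) e₄)

IsBot⇒BotAt : ∀ u s → IsBot (at u s) → BotAt u s
IsBot⇒BotAt u s (isbot e sp sq) with mapS-app⁻ (at u) (out u s) e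
... | s₁ , s₂ , e' , refl , refl =
  s₁ , s₂ , e' , IsSelfApp⇒SelfAppAt u s₁ sp , IsSelfApp⇒SelfAppAt u s₂ sq

BotAt⇒IsBot : ∀ u s → BotAt u s → IsBot (at u s)
BotAt⇒IsBot u s (s₁ , s₂ , e , p , q) =
  isbot (cong (mapS (at u)) e) (SelfAppAt⇒IsSelfApp u s₁ p) (SelfAppAt⇒IsSelfApp u s₂ q)

SelfAppAt-resp-out : ∀ {u a b} → out u a ≡ out u b → SelfAppAt u b → SelfAppAt u a
SelfAppAt-resp-out e (b , x , y , e₁ , e₂ , e₃ , e₄) = b , x , y , trans e e₁ , e₂ , e₃ , e₄

-- Approximation

Greatest-at : ∀ {F t t'} (g : Greatest F t t') {x y} → Greatest.R g x y → Greatest F x y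
Greatest-at g r = record { R = Greatest.R g ; post = Greatest.post g ; holds = r }

ApproxStep-map : ∀ {R R' : Rel₁} → (∀ {a b} → R a b → R' a b) → ∀ {t t'} →
                 ApproxStep R t t' → ApproxStep R' t t'
ApproxStep-map f (a-bot b)          = a-bot b
ApproxStep-map f (a-var e e')       = a-var e e'
ApproxStep-map f (a-con e e')       = a-con e e'
ApproxStep-map f (a-lam e e' r)     = a-lam e e' (f r)
ApproxStep-map f (a-app e e' r₁ r₂) = a-app e e' (f r₁) (f r₂)
ApproxStep-map f (a-case e e' r rs) = a-case e e' (f r) (λ k → f (rs k))

ApproxStep⇒LayerRel : ∀ {R : Rel₁} {t t'} → ApproxStep R t t' → IsBot t' ⊎ LayerRel R (node t) (node t')
ApproxStep⇒LayerRel (a-bot b)          = inj₁ b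
ApproxStep⇒LayerRel (a-var e e')       = inj₂ (LayerRel-atNodes e e' var)
ApproxStep⇒LayerRel (a-con e e')       = inj₂ (LayerRel-atNodes e e' con)
ApproxStep⇒LayerRel (a-lam e e' r)     = inj₂ (LayerRel-atNodes e e' (lam r))
ApproxStep⇒LayerRel (a-app e e' r₁ r₂) = inj₂ (LayerRel-atNodes e e' (app r₁ r₂))
ApproxStep⇒LayerRel (a-case e e' r rs) = inj₂ (LayerRel-atNodes e e' (case r rs))

≻-unfold : ∀ {t t'} → t ≻ t' → IsBot t' ⊎ LayerRel _≻_ (node t) (node t')
≻-unfold g = map₂ (LayerRel-map (Greatest-at g)) (ApproxStep⇒LayerRel (Greatest.post g _ _ (Greatest.holds g)))

-- The witness is the pair itself together with the witnesses of all children.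
≻-byLayer : ∀ {I : Set} (a b : I → Term) → (∀ i → a i ≻ b i) → ∀ {t t'} →
            (∀ {R : Rel₁} → (∀ i → R (a i) (b i)) → ApproxStep R t t') → t ≻ t'
≻-byLayer {I} a b gs {t} {t'} top = record { R = R ; post = post ; holds = inj₁ (refl , refl) }
  where
  R : Rel₁
  R x y = (x ≡ t × y ≡ t') ⊎ Σ I λ i → Greatest.R (gs i) x y
  post : ∀ x y → R x y → ApproxStep R x y
  post _ _ (inj₁ (refl , refl)) = top (λ i → inj₂ (i , Greatest.holds (gs i)))
  post x y (inj₂ (i , r))       = ApproxStep-map (λ r' → inj₂ (i , r')) (Greatest.post (gs i) x y r)

≻-⊥ : ∀ {t t'} → IsBot t' → t ≻ t'
≻-⊥ b = ≻-byLayer {⊥} (λ ()) (λ ()) (λ ()) (λ _ → a-bot b)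

≻-layer : ∀ {t t' nd nd'} → node t ≡ nd → node t' ≡ nd' → LayerRel _≻_ nd nd' → t ≻ t'
≻-layer e e' var = ≻-byLayer {⊥} (λ ()) (λ ()) (λ ()) (λ _ → a-var e e')
≻-layer e e' con = ≻-byLayer {⊥} (λ ()) (λ ()) (λ ()) (λ _ → a-con e e')
≻-layer e e' (lam g) = ≻-byLayer {⊤} _ _ (λ _ → g) (λ rs → a-lam e e' (rs tt))
≻-layer e e' (app {p₁} {p₂} {p₁'} {p₂'} g₁ g₂) =
  ≻-byLayer (λ i → if i then p₁ else p₂) (λ i → if i then p₁' else p₂')
            (λ { true → g₁ ; false → g₂ }) (λ rs → a-app e e' (rs true) (rs false))
≻-layer e e' (case {p} {p'} {ps = ps} {ps'} g gs) =
  ≻-byLayer (maybe′ ps p) (maybe′ ps' p') (λ { nothing → g ; (just k) → gs k })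
            (λ rs → a-case e e' (rs nothing) (λ k → rs (just k)))

≻-refl : ∀ t → t ≻ t
≻-refl t = record { R = Same ; post = post ; holds = lift refl }
  where
  Same : Rel₁
  Same x y = Lift 0ℓ (x ≡ y)
  post : ∀ x y → Same x y → ApproxStep Same x y
  post x _ (lift refl) with node x in e
  ... | var _          = a-var e e
  ... | con _          = a-con e e
  ... | lam _          = a-lam e e (lift refl)
  ... | app _ _        = a-app e e (lift refl) (lift refl)
  ... | case _ _ _ _ _ = a-case e e (lift refl) (λ _ → lift refl)

module _ {t t' : Term} (g : t ≻ t') where

  ≻-con⁻ : ∀ {c} → node t' ≡ con c → node t ≡ con c
  ≻-con⁻ e with ≻-unfold g
  ... | inj₁ (isbot e' _ _) with trans (sym e) e'
  ...   | ()
  ≻-con⁻ e | inj₂ l = LayerRel-conʳ⁻ (≡.subst (LayerRel _ _) e l)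

  ≻-lam⁻ : ∀ {b} → node t' ≡ lam b → Σ Term λ q → node t ≡ lam q × q ≻ b
  ≻-lam⁻ e with ≻-unfold g
  ... | inj₁ (isbot e' _ _) with trans (sym e) e'
  ...   | ()
  ≻-lam⁻ e | inj₂ l = LayerRel-lamʳ⁻ (≡.subst (LayerRel _ _) e l)

  ≻-app⁻ : ∀ {p₁ p₂} → node t' ≡ app p₁ p₂ →
           (IsSelfApp p₁ × IsSelfApp p₂) ⊎
           (Σ Term λ q₁ → Σ Term λ q₂ → node t ≡ app q₁ q₂ × q₁ ≻ p₁ × q₂ ≻ p₂)
  ≻-app⁻ e with ≻-unfold g
  ... | inj₁ (isbot e' sp sq) with trans (sym e) e'
  ...   | refl = inj₁ (sp , sq)
  ≻-app⁻ e | inj₂ l = inj₂ (LayerRel-appʳ⁻ (≡.subst (LayerRel _ _) e l))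

  ≻-case⁻ : ∀ {p n cs ar ps} → node t' ≡ case p n cs ar ps →
            Σ Term λ q → Σ (Fin n → Term) λ qs →
              node t ≡ case q n cs ar qs × q ≻ p × (∀ k → qs k ≻ ps k)
  ≻-case⁻ e with ≻-unfold g
  ... | inj₁ (isbot e' _ _) with trans (sym e) e'
  ...   | ()
  ≻-case⁻ e | inj₂ l = LayerRel-caseʳ⁻ (≡.subst (LayerRel _ _) e l)

data ApproxStepAt (u u' : Term) (Q : St u → St u' → Set₁) (s : St u) (s' : St u') : Set₁ where
  at-bot  : BotAt u' s' → ApproxStepAt u u' Q s s'
  at-var  : ∀ {x} → out u s ≡ var x → out u' s' ≡ var x → ApproxStepAt u u' Q s s'
  at-con  : ∀ {c} → out u s ≡ con c → out u' s' ≡ con c → ApproxStepAt u u' Q s s'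
  at-lam  : ∀ {a a'} → out u s ≡ lam a → out u' s' ≡ lam a' → Q a a' → ApproxStepAt u u' Q s s'
  at-app  : ∀ {a₁ a₂ a₁' a₂'} → out u s ≡ app a₁ a₂ → out u' s' ≡ app a₁' a₂' →
            Q a₁ a₁' → Q a₂ a₂' → ApproxStepAt u u' Q s s'
  at-case : ∀ {a a' n cs ar as as'} → out u s ≡ case a n cs ar as → out u' s' ≡ case a' n cs ar as' →
            Q a a' → (∀ k → Q (as k) (as' k)) → ApproxStepAt u u' Q s s'

ApproxStepAt-resp-out : ∀ {u u' Q a b a' b'} → out u a ≡ out u b → out u' a' ≡ out u' b' →
                        ApproxStepAt u u' Q b b' → ApproxStepAt u u' Q a a'
ApproxStepAt-resp-out e e' (at-bot (s₁ , s₂ , e₂ , p , q)) = at-bot (s₁ , s₂ , trans e' e₂ , p , q)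
ApproxStepAt-resp-out e e' (at-var x y)        = at-var (trans e x) (trans e' y)
ApproxStepAt-resp-out e e' (at-con x y)        = at-con (trans e x) (trans e' y)
ApproxStepAt-resp-out e e' (at-lam x y q)      = at-lam (trans e x) (trans e' y) q
ApproxStepAt-resp-out e e' (at-app x y q₁ q₂)  = at-app (trans e x) (trans e' y) q₁ q₂
ApproxStepAt-resp-out e e' (at-case x y q qs)  = at-case (trans e x) (trans e' y) q qs

≻-coinductionAt : (u u' : Term) (Q : St u → St u' → Set₁) →
                  (∀ s s' → Q s s' → ApproxStepAt u u' Q s s') → ∀ {s s'} → Q s s' → at u s ≻ at u' s'
≻-coinductionAt u u' Q step {s} {s'} q = record { R = R ; post = post ; holds = s , s' , refl , refl , q }
  where
  R : Rel₁
  R x y = Σ (St u) λ s → Σ (St u') λ s' → x ≡ at u s × y ≡ at u' s' × Q s s'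
  related : ∀ {s s'} → Q s s' → R (at u s) (at u' s')
  related q = _ , _ , refl , refl , q
  post : ∀ a b → R a b → ApproxStep R a b
  post _ _ (s , s' , refl , refl , q) with step s s' q
  ... | at-bot b           = a-bot (BotAt⇒IsBot u' s' b)
  ... | at-var e e'        = a-var (cong (mapS (at u)) e) (cong (mapS (at u')) e')
  ... | at-con e e'        = a-con (cong (mapS (at u)) e) (cong (mapS (at u')) e')
  ... | at-lam e e' r      = a-lam (cong (mapS (at u)) e) (cong (mapS (at u')) e') (related r)
  ... | at-app e e' r₁ r₂  = a-app (cong (mapS (at u)) e) (cong (mapS (at u')) e') (related r₁) (related r₂)
  ... | at-case e e' r rs  = a-case (cong (mapS (at u)) e) (cong (mapS (at u')) e')
                                    (related r) (λ k → related (rs k))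

witness-stepAt : ∀ {t t'} (g : t ≻ t') {u u' s s'} → Greatest.R g (at u s) (at u' s') →
                 ApproxStepAt u u' (λ a a' → Greatest.R g (at u a) (at u' a')) s s'
witness-stepAt g {u} {u'} {s} {s'} r with ApproxStep⇒LayerRel (Greatest.post g _ _ r)
... | inj₁ b = at-bot (IsBot⇒BotAt u' s' b)
... | inj₂ l = fromLayer (out u s) (out u' s') refl refl l
  where
  fromLayer : ∀ o o' → out u s ≡ o → out u' s' ≡ o' →
              LayerRel (Greatest.R g) (mapS (at u) o) (mapS (at u') o') →
              ApproxStepAt u u' (λ a a' → Greatest.R g (at u a) (at u' a')) s s'
  fromLayer (var _)          (var _)          e e' var         = at-var e e'
  fromLayer (con _)          (con _)          e e' con         = at-con e e'
  fromLayer (lam _)          (lam _)          e e' (lam r)     = at-lam e e' r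
  fromLayer (app _ _)        (app _ _)        e e' (app r₁ r₂) = at-app e e' r₁ r₂
  fromLayer (case _ _ _ _ _) (case _ _ _ _ _) e e' (case r rs) = at-case e e' r rs

record Hom (u w : Term) : Set where
  field
    map     : St u → St w
    out-map : ∀ s → out w (map s) ≡ mapSS map (out u s)

module _ {u w : Term} (h : Hom u w) where
  open Hom h

  SelfAppAt-map : ∀ {s} → SelfAppAt u s → SelfAppAt w (map s)
  SelfAppAt-map {s} (b , x , y , e₁ , e₂ , e₃ , e₄) =
    map b , map x , map y , trans (out-map s) (cong (mapSS map) e₁) , trans (out-map b) (cong (mapSS map) e₂) ,
    trans (out-map x) (cong (mapSS map) e₃) , trans (out-map y) (cong (mapSS map) e₄)

  BotAt-map : ∀ {s} → BotAt u s → BotAt w (map s)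
  BotAt-map {s} (s₁ , s₂ , e , p , q) =
    map s₁ , map s₂ , trans (out-map s) (cong (mapSS map) e) , SelfAppAt-map p , SelfAppAt-map q

Hom-id : ∀ u → Hom u u
Hom-id u = record { map = λ s → s ; out-map = λ s → mapSS-id (out u s) }
  where
  mapSS-id : ∀ {X : Set} (o : NodeS X) → o ≡ mapSS (λ x → x) o
  mapSS-id (var _)          = refl
  mapSS-id (con _)          = refl
  mapSS-id (lam _)          = refl
  mapSS-id (app _ _)        = refl
  mapSS-id (case _ _ _ _ _) = refl

Hom-mk : ∀ (nd : NodeF Term) (p : Pos nd) → Hom (child nd p) (mk nd)
Hom-mk nd p = record { map = λ s → inj₂ (p , s) ; out-map = λ _ → refl }

≻-Hom : ∀ {u w u' w'} (h : Hom u w) (h' : Hom u' w') → ∀ {s s'} →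
        at u s ≻ at u' s' → at w (Hom.map h s) ≻ at w' (Hom.map h' s')
≻-Hom {u} {w} {u'} {w'} h h' {s} {s'} g = ≻-coinductionAt w w' Q step (s , s' , refl , refl , Greatest.holds g)
  where
  open Hom h
  open Hom h' renaming (map to map'; out-map to out-map')
  Q : St w → St w' → Set₁
  Q x x' = Σ (St u) λ a → Σ (St u') λ a' → x ≡ map a × x' ≡ map' a' × Greatest.R g (at u a) (at u' a')
  related : ∀ {a a'} → Greatest.R g (at u a) (at u' a') → Q (map a) (map' a')
  related r = _ , _ , refl , refl , r
  along : ∀ {a o} → out u a ≡ o → out w (map a) ≡ mapSS map o
  along {a} e = trans (out-map a) (cong (mapSS map) e)
  along' : ∀ {a' o} → out u' a' ≡ o → out w' (map' a') ≡ mapSS map' o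
  along' {a'} e = trans (out-map' a') (cong (mapSS map') e)
  step : ∀ x x' → Q x x' → ApproxStepAt w w' Q x x'
  step _ _ (a , a' , refl , refl , r) with witness-stepAt g {u} {u'} {a} {a'} r
  ... | at-bot b          = at-bot (BotAt-map h' b)
  ... | at-var e e'       = at-var (along e) (along' e')
  ... | at-con e e'       = at-con (along e) (along' e')
  ... | at-lam e e' q     = at-lam (along e) (along' e') (related q)
  ... | at-app e e' q₁ q₂ = at-app (along e) (along' e') (related q₁) (related q₂)
  ... | at-case e e' q qs = at-case (along e) (along' e') (related q) (λ k → related (qs k))

-- node (mk nd) has these copies, not the children of nd themselves, as children
copy : (nd : NodeF Term) → Pos nd → Term
copy nd p = at (mk nd) (inj₂ (p , root (child nd p)))

≻-copyʳ : ∀ {x} nd p → x ≻ child nd p → x ≻ copy nd p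
≻-copyʳ {x} nd p = ≻-Hom (Hom-id x) (Hom-mk nd p)

≻-copy : ∀ nd p nd' p' → child nd p ≻ child nd' p' → copy nd p ≻ copy nd' p'
≻-copy nd p nd' p' = ≻-Hom (Hom-mk nd p) (Hom-mk nd' p')

-- Substitution

module _ (σ : ℕ → Term) (t : Term) where
  private
    S = subst σ t

  body-con : ∀ {s k c} → out t s ≡ con c → out S (inj₁ (s , k)) ≡ con c
  body-con e rewrite e = refl

  body-lam : ∀ {s k a} → out t s ≡ lam a → out S (inj₁ (s , k)) ≡ lam (inj₁ (a , k + 1))
  body-lam e rewrite e = refl

  body-app : ∀ {s k a₁ a₂} → out t s ≡ app a₁ a₂ →
             out S (inj₁ (s , k)) ≡ app (inj₁ (a₁ , k + 0)) (inj₁ (a₂ , k + 0))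
  body-app e rewrite e = refl

  body-case : ∀ {s k a n cs ar as} → out t s ≡ case a n cs ar as →
              out S (inj₁ (s , k)) ≡ case (inj₁ (a , k + 0)) n cs ar (λ i → inj₁ (as i , k + lookup ar i))
  body-case e rewrite e = refl

  body-bound : ∀ {s k x} → out t s ≡ var x → x < k → out S (inj₁ (s , k)) ≡ var x
  body-bound {k = k} {x} e x<k rewrite e with x <? k
  ... | yes _   = refl
  ... | no  x≮k = ⊥-elim (x≮k x<k)

  body-free : ∀ {s k x} → out t s ≡ var x → ¬ x < k →
              out S (inj₁ (s , k)) ≡ out S (inj₂ (x ∸ k , root (σ (x ∸ k)) , k , 0))
  body-free {k = k} {x} e x≮k rewrite e with x <? k
  ... | yes x<k = ⊥-elim (x≮k x<k)
  ... | no  _   = refl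

  arg-con : ∀ {y s k j c} → out (σ y) s ≡ con c → out S (inj₂ (y , s , k , j)) ≡ con c
  arg-con e rewrite e = refl

  arg-lam : ∀ {y s k j a} → out (σ y) s ≡ lam a →
            out S (inj₂ (y , s , k , j)) ≡ lam (inj₂ (y , a , k , j + 1))
  arg-lam e rewrite e = refl

  arg-app : ∀ {y s k j a₁ a₂} → out (σ y) s ≡ app a₁ a₂ →
            out S (inj₂ (y , s , k , j)) ≡ app (inj₂ (y , a₁ , k , j + 0)) (inj₂ (y , a₂ , k , j + 0))
  arg-app e rewrite e = refl

  arg-case : ∀ {y s k j a n cs ar as} → out (σ y) s ≡ case a n cs ar as →
             out S (inj₂ (y , s , k , j)) ≡
               case (inj₂ (y , a , k , j + 0)) n cs ar (λ i → inj₂ (y , as i , k , j + lookup ar i))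
  arg-case e rewrite e = refl

  arg-bound : ∀ {y s k j z} → out (σ y) s ≡ var z → z < j → out S (inj₂ (y , s , k , j)) ≡ var z
  arg-bound {j = j} {z} e z<j rewrite e with z <? j
  ... | yes _   = refl
  ... | no  z≮j = ⊥-elim (z≮j z<j)

  arg-free : ∀ {y s k j z} → out (σ y) s ≡ var z → ¬ z < j → out S (inj₂ (y , s , k , j)) ≡ var (z + k)
  arg-free {j = j} {z} e z≮j rewrite e with z <? j
  ... | yes z<j = ⊥-elim (z≮j z<j)
  ... | no  _   = refl

  private
    0<m+1+0 : ∀ m → 0 < m + 1 + 0
    0<m+1+0 zero    = z<s
    0<m+1+0 (suc m) = z<s

  body-SelfAppAt : ∀ {s} → SelfAppAt t s → ∀ k → SelfAppAt S (inj₁ (s , k))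
  body-SelfAppAt (b , x , y , e₁ , e₂ , e₃ , e₄) k =
    inj₁ (b , k + 1) , inj₁ (x , k + 1 + 0) , inj₁ (y , k + 1 + 0) ,
    body-lam e₁ , body-app e₂ , body-bound e₃ (0<m+1+0 k) , body-bound e₄ (0<m+1+0 k)

  body-BotAt : ∀ {s} → BotAt t s → ∀ k → BotAt S (inj₁ (s , k))
  body-BotAt (s₁ , s₂ , e , p , q) k = _ , _ , body-app e , body-SelfAppAt p _ , body-SelfAppAt q _

  arg-SelfAppAt : ∀ {y s} → SelfAppAt (σ y) s → ∀ k j → SelfAppAt S (inj₂ (y , s , k , j))
  arg-SelfAppAt {y₀} (b , x , y , e₁ , e₂ , e₃ , e₄) k j =
    inj₂ (y₀ , b , k , j + 1) , inj₂ (y₀ , x , k , j + 1 + 0) , inj₂ (y₀ , y , k , j + 1 + 0) ,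
    arg-lam e₁ , arg-app e₂ , arg-bound e₃ (0<m+1+0 j) , arg-bound e₄ (0<m+1+0 j)

  arg-BotAt : ∀ {y s} → BotAt (σ y) s → ∀ k j → BotAt S (inj₂ (y , s , k , j))
  arg-BotAt (s₁ , s₂ , e , p , q) k j = _ , _ , arg-app e , arg-SelfAppAt p _ _ , arg-SelfAppAt q _ _

≻-subst : ∀ {σ σ' t t'} → (∀ y → σ y ≻ σ' y) → t ≻ t' → subst σ t ≻ subst σ' t'
≻-subst {σ} {σ'} {t} {t'} gσ g = ≻-coinductionAt S S' Q step (inBody (Greatest.holds g))
  where
  S = subst σ t
  S' = subst σ' t'

  data Q : St S → St S' → Set₁ where
    inBody : ∀ {s s' k} → Greatest.R g (at t s) (at t' s') → Q (inj₁ (s , k)) (inj₁ (s' , k))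
    inArg  : ∀ {y s s' k j} → Greatest.R (gσ y) (at (σ y) s) (at (σ' y) s') →
             Q (inj₂ (y , s , k , j)) (inj₂ (y , s' , k , j))

  step-arg : ∀ {y s s' k j} → Greatest.R (gσ y) (at (σ y) s) (at (σ' y) s') →
             ApproxStepAt S S' Q (inj₂ (y , s , k , j)) (inj₂ (y , s' , k , j))
  step-arg {y} {s} {s'} {k} {j} r with witness-stepAt (gσ y) {σ y} {σ' y} {s} {s'} r
  ... | at-bot b          = at-bot (arg-BotAt σ' t' b k j)
  ... | at-con e e'       = at-con (arg-con σ t e) (arg-con σ' t' e')
  ... | at-lam e e' q     = at-lam (arg-lam σ t e) (arg-lam σ' t' e') (inArg q)
  ... | at-app e e' q₁ q₂ = at-app (arg-app σ t e) (arg-app σ' t' e') (inArg q₁) (inArg q₂)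
  ... | at-case e e' q qs = at-case (arg-case σ t e) (arg-case σ' t' e') (inArg q) (λ i → inArg (qs i))
  ... | at-var {z} e e' with z <? j
  ...   | yes z<j = at-var (arg-bound σ t e z<j) (arg-bound σ' t' e' z<j)
  ...   | no  z≮j = at-var (arg-free σ t e z≮j) (arg-free σ' t' e' z≮j)

  step-body : ∀ {s s' k} → Greatest.R g (at t s) (at t' s') →
              ApproxStepAt S S' Q (inj₁ (s , k)) (inj₁ (s' , k))
  step-body {s} {s'} {k} r with witness-stepAt g {t} {t'} {s} {s'} r
  ... | at-bot b          = at-bot (body-BotAt σ' t' b k)
  ... | at-con e e'       = at-con (body-con σ t e) (body-con σ' t' e')
  ... | at-lam e e' q     = at-lam (body-lam σ t e) (body-lam σ' t' e') (inBody q)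
  ... | at-app e e' q₁ q₂ = at-app (body-app σ t e) (body-app σ' t' e') (inBody q₁) (inBody q₂)
  ... | at-case e e' q qs = at-case (body-case σ t e) (body-case σ' t' e') (inBody q) (λ i → inBody (qs i))
  ... | at-var {x} e e' with x <? k
  ...   | yes x<k = at-var (body-bound σ t e x<k) (body-bound σ' t' e' x<k)
  ...   | no  x≮k = ApproxStepAt-resp-out (body-free σ t e x≮k) (body-free σ' t' e' x≮k)
                                          (step-arg (Greatest.holds (gσ (x ∸ k))))

  step : ∀ a a' → Q a a' → ApproxStepAt S S' Q a a'
  step _ _ (inBody r) = step-body r
  step _ _ (inArg r)  = step-arg r

≻-consσ : ∀ {u u' σ σ'} → u ≻ u' → (∀ y → σ y ≻ σ' y) →
          ∀ y → consσ u σ y ≻ consσ u' σ' y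
≻-consσ g gσ zero    = g
≻-consσ g gσ (suc y) = gσ y

≻-substListσ : ∀ {σ σ' us us'} → (∀ y → σ y ≻ σ' y) → Pointwise _≻_ us us' →
               ∀ y → substListσ σ us y ≻ substListσ σ' us' y
≻-substListσ gσ []       = gσ
≻-substListσ gσ (g ∷ gs) = ≻-substListσ (≻-consσ g gσ) gs

≻-var' : ∀ y → var' y ≻ var' y
≻-var' y = ≻-refl (var' y)

selfApp-β : ∀ {f a b} → IsSelfApp f → IsSelfApp a → node f ≡ lam b → IsBot (b [ a ≔0])
selfApp-β {f} {a} {b} sf sa e with IsSelfApp⇒SelfAppAt f (root f) sf
... | sb , x , y , e₁ , e₂ , e₃ , e₄ with mapS-lam⁻ (at f) (out f (root f)) e
... | sb' , e' , refl with trans (sym e₁) e'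
... | refl = BotAt⇒IsBot S (root S) (inj₁ (x , 0) , inj₁ (y , 0) , body-app σ b e₂ , self e₃ , self e₄)
  where
  σ = consσ a var'
  S = subst σ b
  aAt : SelfAppAt S (inj₂ (0 , root a , 0 , 0))
  aAt = arg-SelfAppAt σ b {y = 0} {s = root a} (IsSelfApp⇒SelfAppAt a (root a) sa) 0 0
  self : ∀ {z} → out b z ≡ var 0 → SelfAppAt S (inj₁ (z , 0))
  self {z} ez = SelfAppAt-resp-out {S} {inj₁ (z , 0)} {inj₂ (0 , root a , 0 , 0)}
                                   (body-free σ b {s = z} {k = 0} ez (λ ())) aAt

-- Reduction

Reducible : NodeF Term → Set
Reducible (var _) = ⊥
Reducible (con _) = ⊥
Reducible _       = ⊤

⟶-Reducible : ∀ {t z} → t ⟶ z → Reducible (node t)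
⟶-Reducible (β e _)         = ≡.subst Reducible (sym e) tt
⟶-Reducible (ι e _ _ _)     = ≡.subst Reducible (sym e) tt
⟶-Reducible (ξ-lam e _)     = ≡.subst Reducible (sym e) tt
⟶-Reducible (ξ-appˡ e _)    = ≡.subst Reducible (sym e) tt
⟶-Reducible (ξ-appʳ e _)    = ≡.subst Reducible (sym e) tt
⟶-Reducible (ξ-caseˢ e _)   = ≡.subst Reducible (sym e) tt
⟶-Reducible (ξ-caseᵇ e _ _) = ≡.subst Reducible (sym e) tt

var-irreducible : ∀ {t x z} → node t ≡ var x → ¬ (t ⟶ z)
var-irreducible e st = ≡.subst Reducible e (⟶-Reducible st)

⟶-lam⁻ : ∀ {t b z} → node t ≡ lam b → t ⟶ z → Σ Term λ b' → b ⟶ b'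
⟶-lam⁻ e (β e' _) with trans (sym e) e'
... | ()
⟶-lam⁻ e (ι e' _ _ _) with trans (sym e) e'
... | ()
⟶-lam⁻ e (ξ-lam e' st) with trans (sym e) e'
... | refl = _ , st
⟶-lam⁻ e (ξ-appˡ e' _) with trans (sym e) e'
... | ()
⟶-lam⁻ e (ξ-appʳ e' _) with trans (sym e) e'
... | ()
⟶-lam⁻ e (ξ-caseˢ e' _) with trans (sym e) e'
... | ()
⟶-lam⁻ e (ξ-caseᵇ e' _ _) with trans (sym e) e'
... | ()

⟶-app⁻ : ∀ {t f a z} → node t ≡ app f a → t ⟶ z →
         (Σ Term λ b → node f ≡ lam b) ⊎ (Σ Term λ f' → f ⟶ f') ⊎ (Σ Term λ a' → a ⟶ a')
⟶-app⁻ e (β e' ef) with trans (sym e) e'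
... | refl = inj₁ (_ , ef)
⟶-app⁻ e (ι e' _ _ _) with trans (sym e) e'
... | ()
⟶-app⁻ e (ξ-lam e' _) with trans (sym e) e'
... | ()
⟶-app⁻ e (ξ-appˡ e' st) with trans (sym e) e'
... | refl = inj₂ (inj₁ (_ , st))
⟶-app⁻ e (ξ-appʳ e' st) with trans (sym e) e'
... | refl = inj₂ (inj₂ (_ , st))
⟶-app⁻ e (ξ-caseˢ e' _) with trans (sym e) e'
... | ()
⟶-app⁻ e (ξ-caseᵇ e' _ _) with trans (sym e) e'
... | ()

selfAppBody-irreducible : ∀ {b x y z} → node b ≡ app x y → node x ≡ var 0 → node y ≡ var 0 →
                          ¬ (b ⟶ z)
selfAppBody-irreducible e ex ey st with ⟶-app⁻ e st
... | inj₁ (_ , ex') with trans (sym ex) ex'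
...   | ()
selfAppBody-irreducible e ex ey st | inj₂ (inj₁ (_ , stx)) = var-irreducible ex stx
selfAppBody-irreducible e ex ey st | inj₂ (inj₂ (_ , sty)) = var-irreducible ey sty

selfApp-irreducible : ∀ {x z} → IsSelfApp x → ¬ (x ⟶ z)
selfApp-irreducible (selfapp e₁ e₂ e₃ e₄) st =
  selfAppBody-irreducible e₂ e₃ e₄ (proj₂ (⟶-lam⁻ e₁ st))

irreducible-⟶* : ∀ {x z} → (∀ {y} → ¬ (x ⟶ y)) → x ⟶* z → z ≡ x
irreducible-⟶* irr ε          = refl
irreducible-⟶* irr (st ◅ _)  = ⊥-elim (irr st)

spine-not-selfApp : ∀ {f c us} → Spine f c us → ¬ IsSelfApp f
spine-not-selfApp (sp-con e) (selfapp e' _ _ _) with trans (sym e) e'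
... | ()
spine-not-selfApp (sp-app e _) (selfapp e' _ _ _) with trans (sym e) e'
... | ()

≻-Spine : ∀ {t t' c us} → t ≻ t' → Spine t' c us →
          Σ (List Term) λ us' → Spine t c us' × Pointwise _≻_ us' us
≻-Spine g (sp-con e) = [] , sp-con (≻-con⁻ g e) , []
≻-Spine g (sp-app e sp) with ≻-app⁻ g e
... | inj₁ (selfF , _) = ⊥-elim (spine-not-selfApp sp selfF)
... | inj₂ (_ , _ , e' , g₁ , g₂) with ≻-Spine g₁ sp
...   | us' , sp' , gs = us' ++ [ _ ] , sp-app e' sp' , ++⁺ gs (g₂ ∷ [])

module _ {n} {k : Fin n} where

  ≻-updFʳ : ∀ {ps bs : Fin n → Term} {b} → (∀ j → ps j ≻ bs j) → ps k ≻ b →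
            ∀ j → ps j ≻ updF bs k b j
  ≻-updFʳ gs g j with j Fin.≟ k
  ... | yes refl = g
  ... | no  _    = gs j

  ≻-updF : ∀ {ps bs : Fin n → Term} {q b} → (∀ j → ps j ≻ bs j) → q ≻ b →
           ∀ j → updF ps k q j ≻ updF bs k b j
  ≻-updF gs g j with j Fin.≟ k
  ... | yes refl = g
  ... | no  _    = gs j

-- When the redex is a ⊥ of t', no step of t is needed: ⊥ reduces to ⊥.
≻-β : ∀ {t t' f a b} → t ≻ t' → node t' ≡ app f a → node f ≡ lam b →
      (t ≻ (b [ a ≔0])) ⊎ (Σ Term λ r → (t ⟶ r) × (r ≻ (b [ a ≔0])))
≻-β g e₁ e₂ with ≻-app⁻ g e₁
... | inj₁ (selfF , selfA) = inj₁ (≻-⊥ (selfApp-β selfF selfA e₂))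
... | inj₂ (_ , _ , e , g₁ , g₂) with ≻-lam⁻ g₁ e₂
...   | _ , e' , gb = inj₂ (_ , β e e' , ≻-subst (≻-consσ g₂ ≻-var') gb)

≻-ι : ∀ {t t' s n cs ar bs us} → t ≻ t' → node t' ≡ case s n cs ar bs → (k : Fin n) →
      Spine s (lookup cs k) us → length us ≡ lookup ar k → Σ Term λ r → (t ⟶ r) × (r ≻ (bs k [ us ]*))
≻-ι g e₁ k sp len with ≻-case⁻ g e₁
... | _ , _ , e , g₀ , gbs with ≻-Spine g₀ sp
...   | _ , sp' , gus =
  _ , ι e k sp' (trans (Pointwise-length gus) len) , ≻-subst (≻-substListσ ≻-var' gus) (gbs k)

≻-⟶ : ∀ {t t' r'} → t ≻ t' → t' ⟶ r' → (t ≻ r') ⊎ (Σ Term λ r → (t ⟶ r) × (r ≻ r'))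
≻-⟶ g (β e₁ e₂)        = ≻-β g e₁ e₂
≻-⟶ g (ι e₁ k sp len)  = inj₂ (≻-ι g e₁ k sp len)
≻-⟶ g (ξ-lam {b' = b'} e₁ st) with ≻-lam⁻ g e₁
... | _ , e , gb with ≻-⟶ gb st
...   | inj₁ g' = inj₁ (≻-layer e refl (lam (≻-copyʳ (lam b') tt g')))
...   | inj₂ (q , st' , g') =
  inj₂ (_ , ξ-lam e st' , ≻-layer refl refl (lam (≻-copy (lam q) tt (lam b') tt g')))
≻-⟶ g (ξ-appˡ {f' = f'} {a = a} e₁ st) with ≻-app⁻ g e₁
... | inj₁ (selfF , _) = ⊥-elim (selfApp-irreducible selfF st)
... | inj₂ (_ , p , e , g₁ , g₂) with ≻-⟶ g₁ st
...   | inj₁ g' = inj₁ (≻-layer e refl (app (≻-copyʳ nd true g') (≻-copyʳ nd false g₂)))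
  where nd = app f' a
...   | inj₂ (q , st' , g') = inj₂ (_ , ξ-appˡ e st' ,
          ≻-layer refl refl (app (≻-copy (app q p) true nd true g') (≻-copy (app q p) false nd false g₂)))
  where nd = app f' a
≻-⟶ g (ξ-appʳ {f = f} {a' = a'} e₁ st) with ≻-app⁻ g e₁
... | inj₁ (_ , selfA) = ⊥-elim (selfApp-irreducible selfA st)
... | inj₂ (p , _ , e , g₁ , g₂) with ≻-⟶ g₂ st
...   | inj₁ g' = inj₁ (≻-layer e refl (app (≻-copyʳ nd true g₁) (≻-copyʳ nd false g')))
  where nd = app f a'
...   | inj₂ (q , st' , g') = inj₂ (_ , ξ-appʳ e st' ,
          ≻-layer refl refl (app (≻-copy (app p q) true nd true g₁) (≻-copy (app p q) false nd false g')))
  where nd = app f a'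
≻-⟶ g (ξ-caseˢ {s' = s'} {n = n} {cs = cs} {ar = ar} {bs = bs} e₁ st) with ≻-case⁻ g e₁
... | _ , ps , e , g₀ , gbs with ≻-⟶ g₀ st
...   | inj₁ g' =
  inj₁ (≻-layer e refl (case (≻-copyʳ nd nothing g') (λ j → ≻-copyʳ nd (just j) (gbs j))))
  where nd = case s' n cs ar bs
...   | inj₂ (q , st' , g') = inj₂ (_ , ξ-caseˢ e st' ,
          ≻-layer refl refl (case (≻-copy nd' nothing nd nothing g')
                                  (λ j → ≻-copy nd' (just j) nd (just j) (gbs j))))
  where nd = case s' n cs ar bs
        nd' = case q n cs ar ps
≻-⟶ g (ξ-caseᵇ {s = s} {n = n} {cs = cs} {ar = ar} {bs = bs} {b' = b'} e₁ k st) with ≻-case⁻ g e₁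
... | p , ps , e , g₀ , gbs with ≻-⟶ (gbs k) st
...   | inj₁ g' =
  inj₁ (≻-layer e refl (case (≻-copyʳ nd nothing g₀) (λ j → ≻-copyʳ nd (just j) (≻-updFʳ gbs g' j))))
  where nd = case s n cs ar (updF bs k b')
...   | inj₂ (q , st' , g') = inj₂ (_ , ξ-caseᵇ e k st' ,
          ≻-layer refl refl (case (≻-copy nd' nothing nd nothing g₀)
                                  (λ j → ≻-copy nd' (just j) nd (just j) (≻-updF gbs g' j))))
  where nd = case s n cs ar (updF bs k b')
        nd' = case p n cs ar (updF ps k q)

≻-⟶* : ∀ {t t' r'} → t ≻ t' → t' ⟶* r' → Σ Term λ r → (t ⟶* r) × (r ≻ r')
≻-⟶* g ε = _ , ε , g
≻-⟶* g (st ◅ sts) with ≻-⟶ g st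
... | inj₁ g' = ≻-⟶* g' sts
... | inj₂ (r , st' , g') with ≻-⟶* g' sts
...   | r'' , sts' , g'' = r'' , st' ◅ sts' , g''

-- Infinitary reduction

⟶∞-unfold : ∀ {t t'} → t ⟶∞ t' → Σ Term λ r → (t ⟶* r) × LayerRel _⟶∞_ (node r) (node t')
⟶∞-unfold h with Greatest.post h _ _ (Greatest.holds h)
... | i-var st e e'       = _ , st , LayerRel-atNodes e e' var
... | i-con st e e'       = _ , st , LayerRel-atNodes e e' con
... | i-lam st e e' r     = _ , st , LayerRel-atNodes e e' (lam (Greatest-at h r))
... | i-app st e e' r₁ r₂ = _ , st , LayerRel-atNodes e e' (app (Greatest-at h r₁) (Greatest-at h r₂))
... | i-case st e e' r rs = _ , st , LayerRel-atNodes e e' (case (Greatest-at h r) (λ k → Greatest-at h (rs k)))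

⟶∞-irreducible : ∀ {x y nd} → node x ≡ nd → (∀ {z} → ¬ (x ⟶ z)) → x ⟶∞ y → LayerRel _⟶∞_ nd (node y)
⟶∞-irreducible e irr h with ⟶∞-unfold h
... | _ , st , l with irreducible-⟶* irr st
...   | refl = ≡.subst (λ nd → LayerRel _ nd _) e l

var-⟶∞ : ∀ {x y n} → node x ≡ var n → x ⟶∞ y → node y ≡ var n
var-⟶∞ e h = LayerRel-varˡ⁻ (⟶∞-irreducible e (var-irreducible e) h)

selfApp-⟶∞ : ∀ {x y} → IsSelfApp x → x ⟶∞ y → IsSelfApp y
selfApp-⟶∞ sx@(selfapp e₁ e₂ e₃ e₄) h with LayerRel-lamˡ⁻ (⟶∞-irreducible e₁ (selfApp-irreducible sx) h)
... | _ , e , hb with LayerRel-appˡ⁻ (⟶∞-irreducible e₂ (selfAppBody-irreducible e₂ e₃ e₄) hb)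
...   | _ , _ , e' , hx , hy = selfapp e e' (var-⟶∞ e₃ hx) (var-⟶∞ e₄ hy)

_≻·⟶∞_ : Term → Term → Set₂
a ≻·⟶∞ c = Σ Term λ b → (a ≻ b) × (b ⟶∞ c)

SimLayer : Term → Term → Set₂
SimLayer a c = IsBot c ⊎ (Σ Term λ r → (a ⟶* r) × LayerRel _≻·⟶∞_ (node r) (node c))

≻·⟶∞-layer : ∀ {a c} → a ≻·⟶∞ c → SimLayer a c
≻·⟶∞-layer (b , g , h) with ⟶∞-unfold h
... | r₀ , st , l with ≻-⟶* g st
...   | r , st' , g' with ≻-unfold g'
...     | inj₂ l' = inj₂ (r , st' , LayerRel-trans (λ g h → _ , g , h) l' l)
...     | inj₁ (isbot e sp sq) with LayerRel-appˡ⁻ (≡.subst (λ nd → LayerRel _ nd _) e l)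
...       | _ , _ , e' , h₁ , h₂ = inj₁ (isbot e' (selfApp-⟶∞ sp h₁) (selfApp-⟶∞ sq h₂))

-- Corecursion with large seeds: states must be small, so a state is the path
-- from the root and its seed is recomputed along the path.

data Node₂ (X : Set₂) : Set₂ where
  var  : ℕ → Node₂ X
  con  : ℕ → Node₂ X
  lam  : X → Node₂ X
  app  : X → X → Node₂ X
  case : X → (n : ℕ) → Vec ℕ n → Vec ℕ n → (Fin n → X) → Node₂ X

data Dir : Set where
  ↓body ↓fun ↓arg ↓scrut : Dir
  ↓branch : ℕ → Dir

module Corec {Seed : Set₂} (step : Seed → Node₂ Seed) (seed₀ : Seed) where

  branch : ∀ {n} → (Fin n → Seed) → ℕ → Maybe Seed
  branch {n} xs m with m <? n
  ... | yes m<n = just (xs (fromℕ< m<n))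
  ... | no  _   = nothing

  branch-toℕ : ∀ {n} (xs : Fin n → Seed) k → branch xs (toℕ k) ≡ just (xs k)
  branch-toℕ {n} xs k with toℕ k <? n
  ... | yes k<n = cong (λ j → just (xs j)) (fromℕ<-toℕ k k<n)
  ... | no  k≮n = ⊥-elim (k≮n (toℕ<n k))

  childSeed : Node₂ Seed → Dir → Maybe Seed
  childSeed (lam x)            ↓body       = just x
  childSeed (app x _)          ↓fun        = just x
  childSeed (app _ y)          ↓arg        = just y
  childSeed (case x _ _ _ _)   ↓scrut      = just x
  childSeed (case _ _ _ _ xs)  (↓branch m) = branch xs m
  childSeed _                  _           = nothing

  seedAt : List Dir → Maybe Seed
  seedAt []      = just seed₀
  seedAt (d ∷ p) = seedAt p >>= λ sd → childSeed (step sd) d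

  shape : Node₂ Seed → List Dir → NodeS (List Dir)
  shape (var x)            p = var x
  shape (con c)            p = con c
  shape (lam _)            p = lam (↓body ∷ p)
  shape (app _ _)          p = app (↓fun ∷ p) (↓arg ∷ p)
  shape (case _ n cs ar _) p = case (↓scrut ∷ p) n cs ar (λ k → ↓branch (toℕ k) ∷ p)

  -- paths that leave the tree are never reached from the root; var 0 is junk
  tree : Term
  tree = record { St = List Dir ; root = [] ; out = λ p → maybe′ (λ sd → shape (step sd) p) (var 0) (seedAt p) }

  node-tree : ∀ p {sd nd} → seedAt p ≡ just sd → step sd ≡ nd →
              node (at tree p) ≡ mapS (at tree) (shape nd p)
  node-tree p e e' rewrite e | e' = refl

  seedAt-child : ∀ p {sd nd} d → seedAt p ≡ just sd → step sd ≡ nd → seedAt (d ∷ p) ≡ childSeed nd d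
  seedAt-child p d e e' rewrite e | e' = refl

  seedAt-branch : ∀ p {sd x n cs ar xs} (k : Fin n) → seedAt p ≡ just sd → step sd ≡ case x n cs ar xs →
                  seedAt (↓branch (toℕ k) ∷ p) ≡ just (xs k)
  seedAt-branch p {xs = xs} k e e' rewrite e | e' = branch-toℕ xs k

-- Approximation commutes with infinitary reduction

SimSeed : Set₂
SimSeed = (Σ Term λ a → Σ Term λ c → a ≻·⟶∞ c) ⊎ Term

active : ∀ {a c} → a ≻·⟶∞ c → SimSeed
active {a} {c} h = inj₁ (a , c , h)

copyNode : NodeF Term → Node₂ SimSeed
copyNode (var x)             = var x
copyNode (con c)             = con c
copyNode (lam b)             = lam (inj₂ b)
copyNode (app f a)           = app (inj₂ f) (inj₂ a)
copyNode (case s n cs ar bs) = case (inj₂ s) n cs ar (λ k → inj₂ (bs k))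

activeNode : ∀ {nd nd'} → LayerRel _≻·⟶∞_ nd nd' → Node₂ SimSeed
activeNode (var {x})                    = var x
activeNode (con {c})                    = con c
activeNode (lam h)                      = lam (active h)
activeNode (app h₁ h₂)                  = app (active h₁) (active h₂)
activeNode (case {n = n} {cs} {ar} h hs) = case (active h) n cs ar (λ k → active (hs k))

-- Once the approximated term is ⊥, the rest of the source is copied unreduced.
simStep : ∀ a {c} → SimLayer a c → Node₂ SimSeed
simStep a (inj₁ _)           = copyNode (node a)
simStep a (inj₂ (_ , _ , l)) = activeNode l

stepSeed : SimSeed → Node₂ SimSeed
stepSeed (inj₁ (a , _ , h)) = simStep a (≻·⟶∞-layer h)
stepSeed (inj₂ x)           = copyNode (node x)

source : Maybe SimSeed → Term
source (just (inj₁ (a , _))) = a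
source (just (inj₂ x))       = x
source nothing               = var' 0

target : Maybe SimSeed → Term
target (just (inj₁ (_ , c , _))) = c
target _                         = var' 0

isActive : Maybe SimSeed → Bool
isActive (just (inj₁ _)) = true
isActive _               = false

module Simulation {a c : Term} (h : a ≻·⟶∞ c) where
  open Corec stepSeed (active h)

  Reduces : Rel₁
  Reduces x y = Σ (List Dir) λ p → y ≡ at tree p × x ≡ source (seedAt p) × T (is-just (seedAt p))

  reduces : ∀ p {sd} → seedAt p ≡ just sd → Reduces (source (just sd)) (at tree p)
  reduces p e = p , refl , cong source (sym e) , ≡.subst (λ m → T (is-just m)) (sym e) tt

  copy-reduces : ∀ {x nd} p {sd} → node x ≡ nd → seedAt p ≡ just sd → stepSeed sd ≡ copyNode nd →
                 InfStep Reduces x (at tree p)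
  copy-reduces {nd = var _} p e e₁ e₂ = i-var ε e (node-tree p e₁ e₂)
  copy-reduces {nd = con _} p e e₁ e₂ = i-con ε e (node-tree p e₁ e₂)
  copy-reduces {nd = lam _} p e e₁ e₂ =
    i-lam ε e (node-tree p e₁ e₂) (reduces (↓body ∷ p) (seedAt-child p ↓body e₁ e₂))
  copy-reduces {nd = app _ _} p e e₁ e₂ =
    i-app ε e (node-tree p e₁ e₂) (reduces (↓fun ∷ p) (seedAt-child p ↓fun e₁ e₂))
                                  (reduces (↓arg ∷ p) (seedAt-child p ↓arg e₁ e₂))
  copy-reduces {nd = case _ _ _ _ _} p e e₁ e₂ =
    i-case ε e (node-tree p e₁ e₂) (reduces (↓scrut ∷ p) (seedAt-child p ↓scrut e₁ e₂))
                                   (λ k → reduces (↓branch (toℕ k) ∷ p) (seedAt-branch p k e₁ e₂))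

  active-reduces : ∀ {x r nd nd'} p {sd} → x ⟶* r → node r ≡ nd → (l : LayerRel _≻·⟶∞_ nd nd') →
                   seedAt p ≡ just sd → stepSeed sd ≡ activeNode l → InfStep Reduces x (at tree p)
  active-reduces p st e var e₁ e₂ = i-var st e (node-tree p e₁ e₂)
  active-reduces p st e con e₁ e₂ = i-con st e (node-tree p e₁ e₂)
  active-reduces p st e (lam _) e₁ e₂ =
    i-lam st e (node-tree p e₁ e₂) (reduces (↓body ∷ p) (seedAt-child p ↓body e₁ e₂))
  active-reduces p st e (app _ _) e₁ e₂ =
    i-app st e (node-tree p e₁ e₂) (reduces (↓fun ∷ p) (seedAt-child p ↓fun e₁ e₂))
                                   (reduces (↓arg ∷ p) (seedAt-child p ↓arg e₁ e₂))
  active-reduces p st e (case _ _) e₁ e₂ =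
    i-case st e (node-tree p e₁ e₂) (reduces (↓scrut ∷ p) (seedAt-child p ↓scrut e₁ e₂))
                                    (λ k → reduces (↓branch (toℕ k) ∷ p) (seedAt-branch p k e₁ e₂))

  reduces-post : ∀ x y → Reduces x y → InfStep Reduces x y
  reduces-post _ _ (p , refl , refl , defined) with seedAt p in e
  ... | nothing = ⊥-elim defined
  ... | just (inj₂ x) = copy-reduces p refl e refl
  ... | just (inj₁ (x , _ , h')) with ≻·⟶∞-layer h' in es
  ...   | inj₁ _            = copy-reduces p refl e (cong (simStep x) es)
  ...   | inj₂ (_ , st , l) = active-reduces p st refl l e (cong (simStep x) es)

  Approximates : Rel₁
  Approximates y z = Σ (List Dir) λ p → y ≡ at tree p × z ≡ target (seedAt p) × T (isActive (seedAt p))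

  approximates : ∀ p {x z h'} → seedAt p ≡ just (inj₁ (x , z , h')) → Approximates (at tree p) z
  approximates p e = p , refl , cong target (sym e) , ≡.subst (λ m → T (isActive m)) (sym e) tt

  active-approximates : ∀ {z nd nd'} p {sd} → node z ≡ nd' → (l : LayerRel _≻·⟶∞_ nd nd') →
                        seedAt p ≡ just sd → stepSeed sd ≡ activeNode l → ApproxStep Approximates (at tree p) z
  active-approximates p e var e₁ e₂ = a-var (node-tree p e₁ e₂) e
  active-approximates p e con e₁ e₂ = a-con (node-tree p e₁ e₂) e
  active-approximates p e (lam _) e₁ e₂ =
    a-lam (node-tree p e₁ e₂) e (approximates (↓body ∷ p) (seedAt-child p ↓body e₁ e₂))
  active-approximates p e (app _ _) e₁ e₂ =
    a-app (node-tree p e₁ e₂) e (approximates (↓fun ∷ p) (seedAt-child p ↓fun e₁ e₂))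
                                (approximates (↓arg ∷ p) (seedAt-child p ↓arg e₁ e₂))
  active-approximates p e (case _ _) e₁ e₂ =
    a-case (node-tree p e₁ e₂) e (approximates (↓scrut ∷ p) (seedAt-child p ↓scrut e₁ e₂))
                                 (λ k → approximates (↓branch (toℕ k) ∷ p) (seedAt-branch p k e₁ e₂))

  approximates-post : ∀ y z → Approximates y z → ApproxStep Approximates y z
  approximates-post _ _ (p , refl , refl , isAct) with seedAt p in e
  ... | nothing       = ⊥-elim isAct
  ... | just (inj₂ _) = ⊥-elim isAct
  ... | just (inj₁ (x , _ , h')) with ≻·⟶∞-layer h' in es
  ...   | inj₁ b            = a-bot b
  ...   | inj₂ (_ , _ , l) = active-approximates p refl l e (cong (simStep x) es)

  ⟶∞-tree : a ⟶∞ tree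
  ⟶∞-tree = record { R = Reduces ; post = reduces-post ; holds = [] , refl , refl , tt }

  tree-≻ : tree ≻ c
  tree-≻ = record { R = Approximates ; post = approximates-post ; holds = [] , refl , refl , tt }

≻-⟶∞ : ∀ {a b c} → a ≻ b → b ⟶∞ c → Σ Term λ s → (a ⟶∞ s) × (s ≻ c)
≻-⟶∞ g h = _ , Simulation.⟶∞-tree (_ , g , h) , Simulation.tree-≻ (_ , g , h)

-- Closure of the interpretation

≻-appˡ : ∀ {t t'} r → t ≻ t' → app' t r ≻ app' t' r
≻-appˡ {t} {t'} r g =
  ≻-layer refl refl (app (≻-copy (app t r) true (app t' r) true g)
                         (≻-copy (app t r) false (app t' r) false (≻-refl r)))

updT-closed : ∀ {ξ : ℕ → Pred} {X} → (∀ A → ApproxExpansionClosed (ξ A)) → ApproxExpansionClosed X →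
              ∀ B A → ApproxExpansionClosed (updT ξ B X A)
updT-closed hξ hX B A with A ≟ B
... | yes _ = hX
... | no  _ = hξ A

iterK-closed : ∀ K (F : Pred → Pred) → (∀ X → ApproxExpansionClosed X → ApproxExpansionClosed (F X)) →
               ∀ κ → ApproxExpansionClosed (iterK K F κ)
iterK-closed Ind   F hF oz         t t' (lift ()) g
iterK-closed Ind   F hF (os κ)     = hF _ (iterK-closed Ind F hF κ)
iterK-closed Ind   F hF (olim I f) t t' (i , h) g = i , iterK-closed Ind F hF (f i) t t' h g
iterK-closed CoInd F hF oz         t t' h g = lift tt
iterK-closed CoInd F hF (os κ)     = hF _ (iterK-closed CoInd F hF κ)
iterK-closed CoInd F hF (olim I f) t t' h g i = iterK-closed CoInd F hF (f i) t t' (h i) g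

module _ (Sig : ℕ → DataDef) (∞ : Ord) where
  open Semantics Sig ∞

  mutual
    sem-closed : ∀ n (ξ : ℕ → Pred) → (∀ A → ApproxExpansionClosed (ξ A)) → ∀ v τ →
                 ApproxExpansionClosed (sem n ξ v τ)
    sem-closed n ξ hξ v (tvar A) = hξ A
    sem-closed n ξ hξ v (α ⇒ ρ) t t' h g r hr with h r hr
    ... | t'' , red , mem with ≻-⟶∞ (≻-appˡ r g) red
    ...   | s , red' , g' = s , red' , sem-closed n ξ hξ v ρ s t'' mem g'
    sem-closed n ξ hξ v (∀ₛ i τ) t t' h g κ hκ with h κ hκ
    ... | t'' , red , mem with ≻-⟶∞ g red
    ...   | s , red' , g' = s , red' , sem-closed n ξ hξ (updO v i κ) τ s t'' mem g'
    sem-closed zero    ξ hξ v (dat d s αs) t t' (lift ()) g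
    sem-closed (suc n) ξ hξ v (dat d s αs) =
      iterK-closed (kind (Sig d)) (Φ n d ξB v)
                   (Φ-closed n d ξB (bindParams-closed (suc n) ξ hξ v ξ hξ (params (Sig d)) αs) v)
                   (evalS ∞ v s)
      where ξB = bindParams (suc n) ξ v ξ (params (Sig d)) αs

    bindParams-closed : ∀ m (ξ : ℕ → Pred) → (∀ A → ApproxExpansionClosed (ξ A)) → ∀ v acc →
                        (∀ A → ApproxExpansionClosed (acc A)) → ∀ Bs αs →
                        ∀ A → ApproxExpansionClosed (bindParams m ξ v acc Bs αs A)
    bindParams-closed m ξ hξ v acc hacc (B ∷ Bs) (α ∷ αs) =
      bindParams-closed m ξ hξ v (updT acc B (sem m ξ v α)) (updT-closed hacc (sem-closed m ξ hξ v α) B) Bs αs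
    bindParams-closed m ξ hξ v acc hacc []       αs = hacc
    bindParams-closed m ξ hξ v acc hacc (B ∷ Bs) [] = hacc

    Φ-closed : ∀ n d (ξ : ℕ → Pred) → (∀ A → ApproxExpansionClosed (ξ A)) → ∀ v →
               ∀ X → ApproxExpansionClosed X → ApproxExpansionClosed (Φ n d ξ v X)
    Φ-closed n d ξ hξ v X hX t t' (k , us , sp , mems) g with ≻-Spine g sp
    ... | us' , sp' , gs = k , us' , sp' , args-closed gs mems
      where
      ξX = updT ξ (recVar (Sig d)) X
      args-closed : ∀ {as bs σs} → Pointwise _≻_ as bs → Pointwise (λ u σ → sem n ξX v σ u) bs σs →
                    Pointwise (λ u σ → sem n ξX v σ u) as σs
      args-closed []       []           = []
      args-closed {a ∷ _} {b ∷ _} {σ ∷ _} (g ∷ gs) (mem ∷ mems) =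
        sem-closed n ξX (updT-closed hξ hX (recVar (Sig d))) v σ a b mem g ∷ args-closed gs mems

lemma5p27 : (Sig : ℕ → DataDef) → WellFormedSig Sig → (∞ : Ord) →
            (ξ : ℕ → Pred) → (∀ A → ApproxExpansionClosed (ξ A)) →
            (v : ℕ → Ord) → (∀ i → v i ≤ₒ ∞) →
            (τ : Ty) → StrictlyPositive τ →
            ApproxExpansionClosed (Semantics.⟦_⟧ Sig ∞ τ ξ v)
lemma5p27 Sig _ ∞ ξ hξ v _ τ _ = sem-closed Sig ∞ _ ξ hξ v τ
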